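{- Let $t,s$ be non-negative integers. If a $4$-GDD of type $4^t 7^s$ exists, then all of the following hold: $t + s \equiv 1 \pmod{3}$; $s \equiv 0$ or $1 \pmod{4}$; and either $t \geq 4$ or $s \geq 4$.
   Context: A $4$-GDD consists of a finite set $X$ of points, a partition of $X$ into parts called groups, and a collection of $4$-element subsets of $X$ called blocks, such that no block contains two points of the same group and any two points from distinct groups lie together in exactly one block. Type $4^t 7^s$ means there are exactly $t$ groups of size $4$ and $s$ groups of size $7$. -}

module Defs where

open import Data.Nat using (ℕ; _+_; _*_; _≤_)
open import Data.Fin using (Fin; _≟_)
open import Data.List using (List; length; filter; allFin)
open import Data.Vec using (Vec; lookup; toList)
open import Data.Product using (_×_; Σ-syntax)
open import Data.Sum using (_⊎_)
open import Relation.Binary.PropositionalEquality using (_≡_; _≢_)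
open import Relation.Nullary.Decidable using (_×-dec_)
import Data.List.Membership.Propositional
import Data.Nat
import Data.List.Membership.DecPropositional as DecMem

groupSize : {v m : ℕ} → (Fin v → Fin m) → Fin m → ℕ
groupSize {v} γ i = length (filter (λ x → γ x ≟ i) (allFin v))

groupsOfSize : {v m : ℕ} → (Fin v → Fin m) → ℕ → ℕ
groupsOfSize {v} {m} γ k =
  length (filter (λ i → Data.Nat._≟_ (groupSize γ i) k) (allFin m))

-- a block is a 4-tuple of points (read as the 4-set of its entries)
Block : ℕ → Set
Block v = Vec (Fin v) 4

pairCount : {v : ℕ} → List (Block v) → Fin v → Fin v → ℕ
pairCount {v} bs x y =
  length (filter (λ B → (x ∈? toList B) ×-dec (y ∈? toList B)) bs)
  where open DecMem (_≟_ {v})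

record GDD4 (v m : ℕ) : Set where
  field
    group     : Fin v → Fin m
    nonempty  : (i : Fin m) → Σ[ x ∈ Fin v ] group x ≡ i
    blocks    : List (Block v)
    transversal : (B : Block v) → Data.List.Membership.Propositional._∈_ B blocks →
                  (i j : Fin 4) → i ≢ j → group (lookup B i) ≢ group (lookup B j)
    balanced  : (x y : Fin v) → group x ≢ group y → pairCount blocks x y ≡ 1

HasType4t7s : {v m : ℕ} → (Fin v → Fin m) → ℕ → ℕ → Set
HasType4t7s {v} {m} γ t s =
  groupsOfSize γ 4 ≡ t × groupsOfSize γ 7 ≡ s × m ≡ t + s

GDD4Exists : ℕ → ℕ → Set
GDD4Exists t s = Σ[ v ∈ ℕ ] Σ[ m ∈ ℕ ] Σ[ D ∈ GDD4 v m ] HasType4t7s (GDD4.group D) t s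

-- Count the flags through a point x: each of the v − |G(x)| points outside the group G(x) of x
-- shares exactly one block with x, and each of the r(x) blocks through x supplies three of them,
-- so |G(x)| + 3 r(x) = v.  Group sizes 4 and 7 are both ≡ 1 (mod 3) and v = 4t + 7s, which gives
-- t + s ≡ 1 (mod 3).  Summing over x, with Σ r(x) = 4b, gives 16t + 49s + 12b = v², hence
-- s² ≡ s (mod 4).  Among t, s < 4 the two congruences leave only the type 4³7¹, where v = 19,
-- b = 22 and every point of the 7-group has r = 4; a block meets that group at most once, so
-- 7 · 4 ≤ b, which is false.
module Submission where

open import Defs
open import Level using (Level)
open import Data.Bool using (if_then_else_)
open import Data.Nat using (ℕ; zero; suc; _+_; _*_; _≤_; _<_; z≤n; s≤s; _%_; NonZero; _≤?_)
import Data.Nat as ℕ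
open import Data.Nat.Properties
  using (+-*-semiring; +-identityʳ; *-identityˡ; *-identityʳ; *-comm; *-assoc; *-distribʳ-+;
         +-mono-≤; +-monoʳ-≤; ≤-reflexive; ≤-trans; ≤-antisym; ≰⇒>; +-cancelˡ-≡; +-cancelʳ-≤;
         *-cancelˡ-≡; module ≤-Reasoning)
open import Data.Nat.DivMod using ([m+kn]%n≡m%n; %-distribˡ-*; m%n<n)
open import Data.Nat.Tactic.RingSolver using (solve-∀)
open import Data.Fin using (Fin; zero; suc; _≟_; fromℕ<)
open import Data.Fin.Properties using (suc-injective; 0≢1+n)
open import Data.Vec using (Vec; []; _∷_; lookup; toList)
open import Data.Vec.Functional using (Vector)
open import Data.Vec.Membership.Propositional.Properties using (∈-toList⁻)
import Data.Vec.Relation.Unary.Any as VecAny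
open import Data.Vec.Relation.Unary.Any.Properties using (lookup-index)
open import Data.List using (List; _∷_; length; filter; tabulate)
import Data.List as List
open import Data.List.Properties using (tabulate-lookup)
open import Data.List.Membership.Propositional using (_∈_; _∉_)
open import Data.List.Membership.Propositional.Properties using (∈-lookup)
open import Data.Product using (_×_; _,_; proj₁; proj₂; ∃; ∃-syntax)
open import Data.Sum using (_⊎_; inj₁; inj₂)
open import Data.Empty using (⊥-elim)
open import Function using (_∘_; id; case_of_)
open import Relation.Nullary using (Dec; yes; no; ¬_; does; ¬?; _×-dec_)
open import Relation.Nullary.Decidable using (from-no)
open import Relation.Unary using (Pred; Decidable)
open import Relation.Binary.PropositionalEquality
open import Algebra.Properties.Semiring.Sum +-*-semiring
  using (sum; sum-syntax; ∑-comm; ∑-distrib-+; *-distribˡ-sum; *-distribʳ-sum; sum-cong-≗;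
         sum-replicate-zero)

private
  variable
    p q : Level
    P : Set p
    Q : Set q

-- Defined through `does` (rather than by matching on yes/no) so that 𝟙[ suc i ≟ suc j ]
-- reduces to 𝟙[ i ≟ j ].
𝟙[_] : Dec P → ℕ
𝟙[ P? ] = if does P? then 1 else 0

𝟙≤1 : (P? : Dec P) → 𝟙[ P? ] ≤ 1
𝟙≤1 (yes _) = s≤s z≤n
𝟙≤1 (no _) = z≤n

𝟙-yes : P → (P? : Dec P) → 𝟙[ P? ] ≡ 1
𝟙-yes _ (yes _) = refl
𝟙-yes p (no ¬p) = ⊥-elim (¬p p)

𝟙-no : ¬ P → (P? : Dec P) → 𝟙[ P? ] ≡ 0
𝟙-no ¬p (yes p) = ⊥-elim (¬p p)
𝟙-no _ (no _) = refl

𝟙-⇔ : (P → Q) → (Q → P) → (P? : Dec P) (Q? : Dec Q) → 𝟙[ P? ] ≡ 𝟙[ Q? ]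
𝟙-⇔ P→Q Q→P (yes p) Q? = sym (𝟙-yes (P→Q p) Q?)
𝟙-⇔ P→Q Q→P (no ¬p) Q? = sym (𝟙-no (¬p ∘ Q→P) Q?)

𝟙+𝟙[¬]≡1 : (P? : Dec P) → 𝟙[ P? ] + 𝟙[ ¬? P? ] ≡ 1
𝟙+𝟙[¬]≡1 (yes _) = refl
𝟙+𝟙[¬]≡1 (no _) = refl

𝟙+𝟙≤1 : (P → ¬ Q) → (P? : Dec P) (Q? : Dec Q) → 𝟙[ P? ] + 𝟙[ Q? ] ≤ 1
𝟙+𝟙≤1 P→¬Q (yes p) (yes q) = ⊥-elim (P→¬Q p q)
𝟙+𝟙≤1 _ (yes _) (no _) = s≤s z≤n
𝟙+𝟙≤1 _ (no _) Q? = 𝟙≤1 Q?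

𝟙+𝟙≡1⇒⊎ : (P? : Dec P) (Q? : Dec Q) → 𝟙[ P? ] + 𝟙[ Q? ] ≡ 1 → P ⊎ Q
𝟙+𝟙≡1⇒⊎ (yes p) _ _ = inj₁ p
𝟙+𝟙≡1⇒⊎ (no _) (yes q) _ = inj₂ q

𝟙[×-dec] : (P? : Dec P) (Q? : Dec Q) → 𝟙[ P? ×-dec Q? ] ≡ 𝟙[ P? ] * 𝟙[ Q? ]
𝟙[×-dec] (yes _) Q? = sym (+-identityʳ 𝟙[ Q? ])
𝟙[×-dec] (no _) _ = refl

𝟙-*-cong : ∀ {a c} (P? : Dec P) → (P → a ≡ c) → 𝟙[ P? ] * a ≡ 𝟙[ P? ] * c
𝟙-*-cong P?@(yes p) a≡c = cong (𝟙[ P? ] *_) (a≡c p)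
𝟙-*-cong (no _) _ = refl

∑-const : ∀ n c → ∑[ i < n ] c ≡ n * c
∑-const zero c = refl
∑-const (suc n) c = cong (c +_) (∑-const n c)

∑-mono-≤ : ∀ {n} {f g : Vector ℕ n} → (∀ i → f i ≤ g i) → sum f ≤ sum g
∑-mono-≤ {zero} _ = z≤n
∑-mono-≤ {suc n} f≤g = +-mono-≤ (f≤g zero) (∑-mono-≤ (f≤g ∘ suc))

∑≤1⇒≤n : ∀ {n} (f : Vector ℕ n) → (∀ i → f i ≤ 1) → sum f ≤ n
∑≤1⇒≤n {n} f f≤1 = ≤-trans (∑-mono-≤ f≤1) (≤-reflexive (trans (∑-const n 1) (*-identityʳ n)))

∑≤1≡n⇒≡1 : ∀ {n} (f : Vector ℕ n) → (∀ i → f i ≤ 1) → sum f ≡ n → ∀ i → f i ≡ 1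
∑≤1≡n⇒≡1 {suc n} f f≤1 ∑f≡n zero = ≤-antisym (f≤1 zero) (+-cancelʳ-≤ n 1 (f zero) (begin
  suc n                   ≡⟨ ∑f≡n ⟨
  f zero + sum (f ∘ suc)  ≤⟨ +-monoʳ-≤ (f zero) (∑≤1⇒≤n (f ∘ suc) (f≤1 ∘ suc)) ⟩
  f zero + n              ∎))
  where open ≤-Reasoning
∑≤1≡n⇒≡1 {suc n} f f≤1 ∑f≡n (suc i) = ∑≤1≡n⇒≡1 (f ∘ suc) (f≤1 ∘ suc) ∑tail≡n i
  where
  ∑tail≡n : sum (f ∘ suc) ≡ n
  ∑tail≡n = +-cancelˡ-≡ 1 _ _
    (trans (cong (_+ sum (f ∘ suc)) (sym (∑≤1≡n⇒≡1 f f≤1 ∑f≡n zero))) ∑f≡n)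

∑-select : ∀ {n} (a : Fin n) (f : Vector ℕ n) → ∑[ i < n ] (𝟙[ i ≟ a ] * f i) ≡ f a
∑-select {suc n} zero f = begin
  1 * f zero + ∑[ i < n ] 0  ≡⟨ cong₂ _+_ (*-identityˡ (f zero)) (sum-replicate-zero n) ⟩
  f zero + 0                 ≡⟨ +-identityʳ (f zero) ⟩
  f zero                     ∎
  where open ≡-Reasoning
∑-select (suc a) f = ∑-select a (f ∘ suc)

∑-𝟙-witness : ∀ {n} {P : Fin n → Set p} (P? : ∀ i → Dec (P i)) → ∑[ i < n ] 𝟙[ P? i ] ≢ 0 → ∃ P
∑-𝟙-witness {n = zero} _ ∑≢0 = ⊥-elim (∑≢0 refl)
∑-𝟙-witness {n = suc n} P? ∑≢0 with P? zero
... | yes p = zero , p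
... | no _ = let i , p = ∑-𝟙-witness (P? ∘ suc) ∑≢0 in suc i , p

∑-𝟙-atMostOne : ∀ {n} {P : Fin n → Set p} (P? : ∀ i → Dec (P i)) →
                (∀ {i j} → P i → P j → i ≡ j) → ∑[ i < n ] 𝟙[ P? i ] ≤ 1
∑-𝟙-atMostOne {n = zero} _ _ = z≤n
∑-𝟙-atMostOne {n = suc n} P? unique with P? zero
... | yes p = ≤-reflexive (cong suc (trans (sum-cong-≗ (λ i → 𝟙-no (λ q → 0≢1+n (unique p q)) (P? (suc i))))
                                            (sum-replicate-zero n)))
... | no _ = ∑-𝟙-atMostOne (P? ∘ suc) (λ p q → suc-injective (unique p q))

module _ {a} {A : Set a} {P : Pred A p} (P? : Decidable P) where

  length-filter-tabulate : ∀ {n} (f : Fin n → A) →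
                           length (filter P? (tabulate f)) ≡ ∑[ i < n ] 𝟙[ P? (f i) ]
  length-filter-tabulate {zero} _ = refl
  length-filter-tabulate {suc n} f with P? (f zero)
  ... | yes _ = cong suc (length-filter-tabulate (f ∘ suc))
  ... | no _ = length-filter-tabulate (f ∘ suc)

  length-filter-lookup : (xs : List A) →
                         length (filter P? xs) ≡ ∑[ k < length xs ] 𝟙[ P? (List.lookup xs k) ]
  length-filter-lookup xs =
    trans (cong (length ∘ filter P?) (sym (tabulate-lookup xs))) (length-filter-tabulate (List.lookup xs))

module _ {v : ℕ} where
  open import Data.List.Membership.DecPropositional (_≟_ {v}) using (_∈?_)

  𝟙[∈∷] : ∀ x y (ys : List (Fin v)) → y ∉ ys → 𝟙[ x ∈? y ∷ ys ] ≡ 𝟙[ x ≟ y ] + 𝟙[ x ∈? ys ]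
  𝟙[∈∷] x y ys y∉ys with x ≟ y | x ∈? ys
  ... | yes refl | yes x∈ys = ⊥-elim (y∉ys x∈ys)
  ... | yes refl | no _ = refl
  ... | no _ | _ = refl

  ∑-∈-toList : ∀ {n} (B : Vec (Fin v) n) → (∀ {i j} → lookup B i ≡ lookup B j → i ≡ j) →
               (f : Vector ℕ v) → ∑[ y < v ] (𝟙[ y ∈? toList B ] * f y) ≡ ∑[ k < n ] f (lookup B k)
  ∑-∈-toList [] _ _ = sum-replicate-zero v
  ∑-∈-toList {suc n} (a ∷ B) injective f = begin
    ∑[ y < v ] (𝟙[ y ∈? a ∷ toList B ] * f y)                 ≡⟨ sum-cong-≗ split ⟩
    ∑[ y < v ] (𝟙[ y ≟ a ] * f y + 𝟙[ y ∈? toList B ] * f y)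
      ≡⟨ ∑-distrib-+ (λ y → 𝟙[ y ≟ a ] * f y) (λ y → 𝟙[ y ∈? toList B ] * f y) ⟩
    ∑[ y < v ] (𝟙[ y ≟ a ] * f y) + ∑[ y < v ] (𝟙[ y ∈? toList B ] * f y)
      ≡⟨ cong₂ _+_ (∑-select a f) (∑-∈-toList B (suc-injective ∘ injective) f) ⟩
    f a + ∑[ k < n ] f (lookup B k)                           ∎
    where
    open ≡-Reasoning
    a∉B : a ∉ toList B
    a∉B a∈B with () ← injective {zero} {suc _} (lookup-index (∈-toList⁻ a∈B))
    split : ∀ y → 𝟙[ y ∈? a ∷ toList B ] * f y ≡ 𝟙[ y ≟ a ] * f y + 𝟙[ y ∈? toList B ] * f y
    split y = trans (cong (_* f y) (𝟙[∈∷] y a (toList B) a∉B))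
                    (*-distribʳ-+ (f y) 𝟙[ y ≟ a ] 𝟙[ y ∈? toList B ])

module _ {v m : ℕ} (γ : Fin v → Fin m) where

  groupSize≡∑ : ∀ i → groupSize γ i ≡ ∑[ x < v ] 𝟙[ γ x ≟ i ]
  groupSize≡∑ i = length-filter-tabulate (λ x → γ x ≟ i) id

  ofSize : ℕ → Vector ℕ m
  ofSize k i = 𝟙[ groupSize γ i ℕ.≟ k ]

  groupsOfSize≡∑ : ∀ k → groupsOfSize γ k ≡ sum (ofSize k)
  groupsOfSize≡∑ k = length-filter-tabulate (λ i → groupSize γ i ℕ.≟ k) id

  ∑-fibres : (h : Vector ℕ m) → ∑[ x < v ] h (γ x) ≡ ∑[ i < m ] (groupSize γ i * h i)
  ∑-fibres h = begin
    ∑[ x < v ] h (γ x)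
      ≡⟨ sum-cong-≗ (λ x → sym (∑-select (γ x) h)) ⟩
    ∑[ x < v ] ∑[ i < m ] (𝟙[ i ≟ γ x ] * h i)
      ≡⟨ sum-cong-≗ (λ x → sum-cong-≗ (λ i → cong (_* h i) (𝟙-⇔ sym sym (i ≟ γ x) (γ x ≟ i)))) ⟩
    ∑[ x < v ] ∑[ i < m ] (𝟙[ γ x ≟ i ] * h i)
      ≡⟨ ∑-comm (λ x i → 𝟙[ γ x ≟ i ] * h i) ⟩
    ∑[ i < m ] ∑[ x < v ] (𝟙[ γ x ≟ i ] * h i)
      ≡⟨ sum-cong-≗ (λ i → sym (*-distribʳ-sum (h i) (λ x → 𝟙[ γ x ≟ i ]))) ⟩
    ∑[ i < m ] (∑[ x < v ] 𝟙[ γ x ≟ i ] * h i)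
      ≡⟨ sum-cong-≗ (λ i → cong (_* h i) (sym (groupSize≡∑ i))) ⟩
    ∑[ i < m ] (groupSize γ i * h i)
      ∎
    where open ≡-Reasoning

  ∑-groupSize : ∑[ i < m ] groupSize γ i ≡ v
  ∑-groupSize = begin
    ∑[ i < m ] groupSize γ i        ≡⟨ sum-cong-≗ (λ i → *-identityʳ (groupSize γ i)) ⟨
    ∑[ i < m ] (groupSize γ i * 1)  ≡⟨ ∑-fibres (λ _ → 1) ⟨
    ∑[ x < v ] 1                    ≡⟨ ∑-const v 1 ⟩
    v * 1                           ≡⟨ *-identityʳ v ⟩
    v                               ∎
    where open ≡-Reasoning

  module _ {t s : ℕ} (type : HasType4t7s γ t s) where
    private
      count₄ : sum (ofSize 4) ≡ t
      count₄ = trans (sym (groupsOfSize≡∑ 4)) (proj₁ type)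
      count₇ : sum (ofSize 7) ≡ s
      count₇ = trans (sym (groupsOfSize≡∑ 7)) (proj₁ (proj₂ type))

    groupSize≡4⊎7 : ∀ i → groupSize γ i ≡ 4 ⊎ groupSize γ i ≡ 7
    groupSize≡4⊎7 i = 𝟙+𝟙≡1⇒⊎ (groupSize γ i ℕ.≟ 4) (groupSize γ i ℕ.≟ 7)
      (∑≤1≡n⇒≡1 (λ j → ofSize 4 j + ofSize 7 j) ofSize4+ofSize7≤1 ∑≡m i)
      where
      4≢7 : ∀ {g} → g ≡ 4 → g ≢ 7
      4≢7 refl ()
      ofSize4+ofSize7≤1 : ∀ j → ofSize 4 j + ofSize 7 j ≤ 1
      ofSize4+ofSize7≤1 j = 𝟙+𝟙≤1 4≢7 (groupSize γ j ℕ.≟ 4) (groupSize γ j ℕ.≟ 7)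
      ∑≡m : ∑[ j < m ] (ofSize 4 j + ofSize 7 j) ≡ m
      ∑≡m = trans (∑-distrib-+ (ofSize 4) (ofSize 7))
                  (trans (cong₂ _+_ count₄ count₇) (sym (proj₂ (proj₂ type))))

    ∑-over-groups : (h : ℕ → ℕ) → ∑[ i < m ] h (groupSize γ i) ≡ t * h 4 + s * h 7
    ∑-over-groups h = begin
      ∑[ i < m ] h (groupSize γ i)
        ≡⟨ sum-cong-≗ (λ i → split (groupSize≡4⊎7 i)) ⟩
      ∑[ i < m ] (ofSize 4 i * h 4 + ofSize 7 i * h 7)
        ≡⟨ ∑-distrib-+ (λ i → ofSize 4 i * h 4) (λ i → ofSize 7 i * h 7) ⟩
      ∑[ i < m ] (ofSize 4 i * h 4) + ∑[ i < m ] (ofSize 7 i * h 7)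
        ≡⟨ cong₂ _+_ (*-distribʳ-sum (h 4) (ofSize 4)) (*-distribʳ-sum (h 7) (ofSize 7)) ⟨
      sum (ofSize 4) * h 4 + sum (ofSize 7) * h 7
        ≡⟨ cong₂ (λ a c → a * h 4 + c * h 7) count₄ count₇ ⟩
      t * h 4 + s * h 7
        ∎
      where
      open ≡-Reasoning
      split : ∀ {g} → g ≡ 4 ⊎ g ≡ 7 → h g ≡ 𝟙[ g ℕ.≟ 4 ] * h 4 + 𝟙[ g ℕ.≟ 7 ] * h 7
      split (inj₁ refl) = sym (trans (+-identityʳ _) (+-identityʳ (h 4)))
      split (inj₂ refl) = sym (+-identityʳ (h 7))

module Incidence {v m : ℕ} (D : GDD4 v m) where
  open GDD4 D
  open import Data.List.Membership.DecPropositional (_≟_ {v}) using (_∈?_)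

  b : ℕ
  b = length blocks

  block : Fin b → Block v
  block = List.lookup blocks

  incidence : Fin v → Fin b → ℕ
  incidence x k = 𝟙[ x ∈? toList (block k) ]

  replication : Fin v → ℕ
  replication x = ∑[ k < b ] incidence x k

  pairCount≡∑ : ∀ x y → pairCount blocks x y ≡ ∑[ k < b ] (incidence x k * incidence y k)
  pairCount≡∑ x y = trans (length-filter-lookup _ blocks)
    (sum-cong-≗ (λ k → 𝟙[×-dec] (x ∈? toList (block k)) (y ∈? toList (block k))))

  block-group-injective : ∀ k {i j} → group (lookup (block k) i) ≡ group (lookup (block k) j) → i ≡ j
  block-group-injective k {i} {j} eq with i ≟ j
  ... | yes i≡j = i≡j
  ... | no i≢j = ⊥-elim (transversal (block k) (∈-lookup k) i j i≢j eq)

  ∑-block : ∀ k (f : Vector ℕ v) → ∑[ y < v ] (incidence y k * f y) ≡ ∑[ j < 4 ] f (lookup (block k) j)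
  ∑-block k = ∑-∈-toList (block k) (block-group-injective k ∘ cong group)

  block-size : ∀ k → ∑[ y < v ] incidence y k ≡ 4
  block-size k = trans (sum-cong-≗ (λ y → sym (*-identityʳ (incidence y k)))) (∑-block k (λ _ → 1))

  block-outside : ∀ k x → x ∈ toList (block k) →
                  ∑[ y < v ] (incidence y k * 𝟙[ ¬? (group y ≟ group x) ]) ≡ 3
  block-outside k x x∈B = begin
    ∑[ y < v ] (incidence y k * 𝟙[ ¬? (group y ≟ group x) ])  ≡⟨ ∑-block k _ ⟩
    ∑[ j < 4 ] 𝟙[ ¬? (group (B j) ≟ group x) ]
      ≡⟨ sum-cong-≗ (λ j → 𝟙-⇔ (_∘ same) (_∘ other) (¬? (group (B j) ≟ group x)) (¬? (j ≟ j₀))) ⟩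
    ∑[ j < 4 ] 𝟙[ ¬? (j ≟ j₀) ]                              ≡⟨ three j₀ ⟩
    3                                                        ∎
    where
    open ≡-Reasoning
    B : Fin 4 → Fin v
    B = lookup (block k)
    j₀ : Fin 4
    j₀ = VecAny.index (∈-toList⁻ x∈B)
    x≡Bj₀ : x ≡ B j₀
    x≡Bj₀ = lookup-index (∈-toList⁻ x∈B)
    same : ∀ {j} → j ≡ j₀ → group (B j) ≡ group x
    same refl = cong group (sym x≡Bj₀)
    other : ∀ {j} → group (B j) ≡ group x → j ≡ j₀
    other eq = block-group-injective k (trans eq (cong group x≡Bj₀))
    three : ∀ j₀ → ∑[ j < 4 ] 𝟙[ ¬? (j ≟ j₀) ] ≡ 3
    three zero = refl
    three (suc zero) = refl
    three (suc (suc zero)) = refl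
    three (suc (suc (suc zero))) = refl

  block-meets-group≤1 : ∀ k i → ∑[ y < v ] (incidence y k * 𝟙[ group y ≟ i ]) ≤ 1
  block-meets-group≤1 k i = ≤-trans (≤-reflexive (∑-block k _))
    (∑-𝟙-atMostOne (λ j → group (lookup (block k) j) ≟ i) (λ p q → block-group-injective k (trans p (sym q))))

  ∑-replication : ∑[ x < v ] replication x ≡ 4 * b
  ∑-replication = begin
    ∑[ x < v ] ∑[ k < b ] incidence x k  ≡⟨ ∑-comm incidence ⟩
    ∑[ k < b ] ∑[ x < v ] incidence x k  ≡⟨ sum-cong-≗ block-size ⟩
    ∑[ k < b ] 4                         ≡⟨ ∑-const b 4 ⟩
    b * 4                                ≡⟨ *-comm b 4 ⟩
    4 * b                                ∎
    where open ≡-Reasoning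

  outside≡3*replication : ∀ x → ∑[ y < v ] 𝟙[ ¬? (group y ≟ group x) ] ≡ 3 * replication x
  outside≡3*replication x = begin
    ∑[ y < v ] o y                                                ≡⟨ sum-cong-≗ o≡o*pairCount ⟩
    ∑[ y < v ] (o y * pairCount blocks x y)                       ≡⟨ sum-cong-≗ (λ y → cong (o y *_) (pairCount≡∑ x y)) ⟩
    ∑[ y < v ] (o y * ∑[ k < b ] (incidence x k * incidence y k))
      ≡⟨ sum-cong-≗ (λ y → *-distribˡ-sum (o y) (λ k → incidence x k * incidence y k)) ⟩
    ∑[ y < v ] ∑[ k < b ] (o y * (incidence x k * incidence y k))
      ≡⟨ ∑-comm (λ y k → o y * (incidence x k * incidence y k)) ⟩
    ∑[ k < b ] ∑[ y < v ] (o y * (incidence x k * incidence y k))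
      ≡⟨ sum-cong-≗ (λ k → sum-cong-≗ (λ y → rotate (o y) (incidence x k) (incidence y k))) ⟩
    ∑[ k < b ] ∑[ y < v ] (incidence x k * (incidence y k * o y))
      ≡⟨ sum-cong-≗ (λ k → *-distribˡ-sum (incidence x k) (λ y → incidence y k * o y)) ⟨
    ∑[ k < b ] (incidence x k * ∑[ y < v ] (incidence y k * o y))
      ≡⟨ sum-cong-≗ (λ k → 𝟙-*-cong (x ∈? toList (block k)) (block-outside k x)) ⟩
    ∑[ k < b ] (incidence x k * 3)                                ≡⟨ *-distribʳ-sum 3 (incidence x) ⟨
    replication x * 3                                             ≡⟨ *-comm (replication x) 3 ⟩
    3 * replication x                                             ∎
    where
    open ≡-Reasoning
    o : Fin v → ℕ
    o y = 𝟙[ ¬? (group y ≟ group x) ]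
    o≡o*pairCount : ∀ y → o y ≡ o y * pairCount blocks x y
    o≡o*pairCount y = trans (sym (*-identityʳ (o y)))
      (𝟙-*-cong (¬? (group y ≟ group x)) (λ ne → sym (balanced x y (ne ∘ sym))))
    rotate : ∀ a c d → a * (c * d) ≡ c * (d * a)
    rotate a c d = trans (*-comm a (c * d)) (*-assoc c d a)

  groupSize+3*replication≡v : ∀ x → groupSize group (group x) + 3 * replication x ≡ v
  groupSize+3*replication≡v x = begin
    groupSize group (group x) + 3 * replication x
      ≡⟨ cong₂ _+_ (groupSize≡∑ group (group x)) (sym (outside≡3*replication x)) ⟩
    ∑[ y < v ] 𝟙[ group y ≟ group x ] + ∑[ y < v ] 𝟙[ ¬? (group y ≟ group x) ]
      ≡⟨ ∑-distrib-+ (λ y → 𝟙[ group y ≟ group x ]) (λ y → 𝟙[ ¬? (group y ≟ group x) ]) ⟨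
    ∑[ y < v ] (𝟙[ group y ≟ group x ] + 𝟙[ ¬? (group y ≟ group x) ])
      ≡⟨ sum-cong-≗ (λ y → 𝟙+𝟙[¬]≡1 (group y ≟ group x)) ⟩
    ∑[ y < v ] 1  ≡⟨ ∑-const v 1 ⟩
    v * 1         ≡⟨ *-identityʳ v ⟩
    v             ∎
    where open ≡-Reasoning

  replication-constant-on-groups : ∀ {x y} → group x ≡ group y → replication x ≡ replication y
  replication-constant-on-groups {x} {y} eq = *-cancelˡ-≡ (replication x) (replication y) 3
    (+-cancelˡ-≡ (groupSize group (group x)) (3 * replication x) (3 * replication y) (begin
      groupSize group (group x) + 3 * replication x  ≡⟨ groupSize+3*replication≡v x ⟩
      v                                              ≡⟨ groupSize+3*replication≡v y ⟨
      groupSize group (group y) + 3 * replication y  ≡⟨ cong (λ i → groupSize group i + 3 * replication y) eq ⟨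
      groupSize group (group x) + 3 * replication y  ∎))
    where open ≡-Reasoning

  ∑-group-replication≤b : ∀ i → ∑[ x < v ] (𝟙[ group x ≟ i ] * replication x) ≤ b
  ∑-group-replication≤b i = begin
    ∑[ x < v ] (g x * replication x)            ≡⟨ sum-cong-≗ (λ x → *-distribˡ-sum (g x) (incidence x)) ⟩
    ∑[ x < v ] ∑[ k < b ] (g x * incidence x k) ≡⟨ ∑-comm (λ x k → g x * incidence x k) ⟩
    ∑[ k < b ] ∑[ x < v ] (g x * incidence x k) ≡⟨ sum-cong-≗ (λ k → sum-cong-≗ (λ x → *-comm (g x) (incidence x k))) ⟩
    ∑[ k < b ] ∑[ x < v ] (incidence x k * g x) ≤⟨ ∑≤1⇒≤n _ (λ k → block-meets-group≤1 k i) ⟩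
    b                                           ∎
    where
    open ≤-Reasoning
    g : Fin v → ℕ
    g x = 𝟙[ group x ≟ i ]

  groupSize*replication≤b : ∀ x → groupSize group (group x) * replication x ≤ b
  groupSize*replication≤b x = begin
    groupSize group (group x) * replication x
      ≡⟨ cong (_* replication x) (groupSize≡∑ group (group x)) ⟩
    ∑[ y < v ] 𝟙[ group y ≟ group x ] * replication x
      ≡⟨ *-distribʳ-sum (replication x) (λ y → 𝟙[ group y ≟ group x ]) ⟩
    ∑[ y < v ] (𝟙[ group y ≟ group x ] * replication x)
      ≡⟨ sum-cong-≗ (λ y → 𝟙-*-cong (group y ≟ group x) (λ eq → replication-constant-on-groups (sym eq))) ⟩
    ∑[ y < v ] (𝟙[ group y ≟ group x ] * replication y)
      ≤⟨ ∑-group-replication≤b (group x) ⟩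
    b ∎
    where open ≤-Reasoning

  ∑-groupSize²+12b≡v² : ∑[ i < m ] (groupSize group i * groupSize group i) + 12 * b ≡ v * v
  ∑-groupSize²+12b≡v² = begin
    ∑[ i < m ] (groupSize group i * groupSize group i) + 12 * b
      ≡⟨ cong₂ _+_ (∑-fibres group (groupSize group))
                   (trans (cong (3 *_) ∑-replication) (sym (*-assoc 3 4 b))) ⟨
    ∑[ x < v ] groupSize group (group x) + 3 * ∑[ x < v ] replication x
      ≡⟨ cong (∑[ x < v ] groupSize group (group x) +_) (*-distribˡ-sum 3 replication) ⟩
    ∑[ x < v ] groupSize group (group x) + ∑[ x < v ] (3 * replication x)
      ≡⟨ ∑-distrib-+ (groupSize group ∘ group) (λ x → 3 * replication x) ⟨
    ∑[ x < v ] (groupSize group (group x) + 3 * replication x)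
      ≡⟨ sum-cong-≗ groupSize+3*replication≡v ⟩
    ∑[ x < v ] v  ≡⟨ ∑-const v v ⟩
    v * v         ∎
    where open ≡-Reasoning

%-cong : ∀ a c k l n .{{_ : NonZero n}} → a + k * n ≡ c + l * n → a % n ≡ c % n
%-cong a c k l n eq = trans (sym ([m+kn]%n≡m%n a k n)) (trans (cong (_% n) eq) ([m+kn]%n≡m%n c l n))

t+s≡1-mod3 : ∀ t s g r → g ≡ 4 ⊎ g ≡ 7 → g + 3 * r ≡ t * 4 + s * 7 → (t + s) % 3 ≡ 1
t+s≡1-mod3 t s g r g≡4⊎7 eq = trans (%-cong (t + s) g (t + 2 * s) r 3 congruence) (g%3≡1 g≡4⊎7)
  where
  open ≡-Reasoning
  regroup : ∀ t s → t + s + (t + 2 * s) * 3 ≡ t * 4 + s * 7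
  regroup = solve-∀
  congruence : t + s + (t + 2 * s) * 3 ≡ g + r * 3
  congruence = begin
    t + s + (t + 2 * s) * 3  ≡⟨ regroup t s ⟩
    t * 4 + s * 7            ≡⟨ eq ⟨
    g + 3 * r                ≡⟨ cong (g +_) (*-comm 3 r) ⟩
    g + r * 3                ∎
  g%3≡1 : g ≡ 4 ⊎ g ≡ 7 → g % 3 ≡ 1
  g%3≡1 (inj₁ refl) = refl
  g%3≡1 (inj₂ refl) = refl

[s*s]%4≡s%4⇒s%4≡0⊎1 : ∀ s → (s * s) % 4 ≡ s % 4 → s % 4 ≡ 0 ⊎ s % 4 ≡ 1
[s*s]%4≡s%4⇒s%4≡0⊎1 s eq = idempotent (s % 4) (m%n<n s 4) (trans (sym (%-distribˡ-* s s 4)) eq)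
  where
  idempotent : ∀ ρ → ρ < 4 → (ρ * ρ) % 4 ≡ ρ → ρ ≡ 0 ⊎ ρ ≡ 1
  idempotent 0 _ _ = inj₁ refl
  idempotent 1 _ _ = inj₂ refl
  idempotent 2 _ ()
  idempotent 3 _ ()
  idempotent (suc (suc (suc (suc _)))) (s≤s (s≤s (s≤s (s≤s ())))) _

s%4≡0⊎1 : ∀ t s b → t * 16 + s * 49 + 12 * b ≡ (t * 4 + s * 7) * (t * 4 + s * 7) →
          s % 4 ≡ 0 ⊎ s % 4 ≡ 1
s%4≡0⊎1 t s b eq = [s*s]%4≡s%4⇒s%4≡0⊎1 s (%-cong (s * s) s k l 4 congruence)
  where
  open ≡-Reasoning
  expand : ∀ t s → s * s + (4 * t * t + 14 * t * s + 12 * s * s) * 4 ≡ (t * 4 + s * 7) * (t * 4 + s * 7)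
  expand = solve-∀
  regroup : ∀ t s b → t * 16 + s * 49 + 12 * b ≡ s + (12 * s + 4 * t + 3 * b) * 4
  regroup = solve-∀
  k l : ℕ
  k = 4 * t * t + 14 * t * s + 12 * s * s
  l = 12 * s + 4 * t + 3 * b
  congruence : s * s + k * 4 ≡ s + l * 4
  congruence = begin
    s * s + k * 4                      ≡⟨ expand t s ⟩
    (t * 4 + s * 7) * (t * 4 + s * 7)  ≡⟨ eq ⟨
    t * 16 + s * 49 + 12 * b           ≡⟨ regroup t s b ⟩
    s + l * 4                          ∎

small-admissible⇒4³7¹ : ∀ t s → t < 4 → s < 4 → 2 ≤ t + s → (t + s) % 3 ≡ 1 → s % 4 ≡ 0 ⊎ s % 4 ≡ 1 →
                         t ≡ 3 × s ≡ 1
small-admissible⇒4³7¹ _ 2 _ _ _ _ (inj₁ ())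
small-admissible⇒4³7¹ _ 2 _ _ _ _ (inj₂ ())
small-admissible⇒4³7¹ _ 3 _ _ _ _ (inj₁ ())
small-admissible⇒4³7¹ _ 3 _ _ _ _ (inj₂ ())
small-admissible⇒4³7¹ 0 0 _ _ () _ _
small-admissible⇒4³7¹ 1 0 _ _ (s≤s ()) _ _
small-admissible⇒4³7¹ 2 0 _ _ _ () _
small-admissible⇒4³7¹ 3 0 _ _ _ () _
small-admissible⇒4³7¹ 0 1 _ _ (s≤s ()) _ _
small-admissible⇒4³7¹ 1 1 _ _ _ () _
small-admissible⇒4³7¹ 2 1 _ _ _ () _
small-admissible⇒4³7¹ 3 1 _ _ _ _ _ = refl , refl
small-admissible⇒4³7¹ (suc (suc (suc (suc _)))) _ (s≤s (s≤s (s≤s (s≤s ())))) _ _ _ _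
small-admissible⇒4³7¹ _ (suc (suc (suc (suc _)))) _ (s≤s (s≤s (s≤s (s≤s ())))) _ _ _

4³7¹-counts-inconsistent : ∀ r b → 7 + 3 * r ≡ 19 → 3 * 16 + 1 * 49 + 12 * b ≡ 19 * 19 → ¬ (7 * r ≤ b)
4³7¹-counts-inconsistent r b r-eq b-eq 7r≤b =
  from-no (28 ≤? 22) (subst₂ (λ r b → 7 * r ≤ b) r≡4 b≡22 7r≤b)
  where
  r≡4 : r ≡ 4
  r≡4 = *-cancelˡ-≡ r 4 3 (+-cancelˡ-≡ 7 (3 * r) 12 r-eq)
  b≡22 : b ≡ 22
  b≡22 = *-cancelˡ-≡ b 22 12 (+-cancelˡ-≡ 97 (12 * b) 264 b-eq)

module TypedIncidence {v m t s : ℕ} (D : GDD4 v m) (type : HasType4t7s (GDD4.group D) t s) where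
  open GDD4 D
  open Incidence D public

  v≡4t+7s : v ≡ t * 4 + s * 7
  v≡4t+7s = trans (sym (∑-groupSize group)) (∑-over-groups group type id)

  16t+49s+12b≡v² : t * 16 + s * 49 + 12 * b ≡ (t * 4 + s * 7) * (t * 4 + s * 7)
  16t+49s+12b≡v² = begin
    t * 16 + s * 49 + 12 * b
      ≡⟨ cong (_+ 12 * b) (∑-over-groups group type (λ g → g * g)) ⟨
    ∑[ i < m ] (groupSize group i * groupSize group i) + 12 * b
      ≡⟨ ∑-groupSize²+12b≡v² ⟩
    v * v
      ≡⟨ cong₂ _*_ v≡4t+7s v≡4t+7s ⟩
    (t * 4 + s * 7) * (t * 4 + s * 7)
      ∎
    where open ≡-Reasoning

GDD4Exists⇒t+s≡1-mod3 : ∀ {t s} → 1 ≤ t + s → GDD4Exists t s → (t + s) % 3 ≡ 1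
GDD4Exists⇒t+s≡1-mod3 {t} {s} 1≤t+s (v , m , D , type) =
  t+s≡1-mod3 t s (groupSize group (group x)) (replication x) (groupSize≡4⊎7 group type (group x))
    (trans (groupSize+3*replication≡v x) v≡4t+7s)
  where
  open GDD4 D
  open TypedIncidence D type
  x : Fin v
  x = proj₁ (nonempty (fromℕ< (subst (1 ≤_) (sym (proj₂ (proj₂ type))) 1≤t+s)))

GDD4Exists⇒s%4≡0⊎1 : ∀ {t s} → GDD4Exists t s → s % 4 ≡ 0 ⊎ s % 4 ≡ 1
GDD4Exists⇒s%4≡0⊎1 {t} {s} (v , m , D , type) = s%4≡0⊎1 t s b 16t+49s+12b≡v²
  where open TypedIncidence D type

¬GDD4Exists-4³7¹ : ¬ GDD4Exists 3 1
¬GDD4Exists-4³7¹ (v , m , D , type) =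
  4³7¹-counts-inconsistent (replication x) b
    (trans (cong (_+ 3 * replication x) (sym |Gx|≡7)) (trans (groupSize+3*replication≡v x) v≡4t+7s))
    16t+49s+12b≡v²
    (subst (λ g → g * replication x ≤ b) |Gx|≡7 (groupSize*replication≤b x))
  where
  open GDD4 D
  open TypedIncidence D type
  seven-group : ∃[ i ] groupSize group i ≡ 7
  seven-group = ∑-𝟙-witness (λ i → groupSize group i ℕ.≟ 7) (λ ∑≡0 →
    case trans (sym ∑≡0) (trans (sym (groupsOfSize≡∑ group 7)) (proj₁ (proj₂ type))) of λ ())
  x : Fin v
  x = proj₁ (nonempty (proj₁ seven-group))
  |Gx|≡7 : groupSize group (group x) ≡ 7
  |Gx|≡7 = trans (cong (groupSize group) (proj₂ (nonempty (proj₁ seven-group)))) (proj₂ seven-group)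

mainTheorem4 : (t s : ℕ) → 2 ≤ t + s → GDD4Exists t s →
    ((t + s) % 3 ≡ 1) × ((s % 4 ≡ 0) ⊎ (s % 4 ≡ 1)) × ((4 ≤ t) ⊎ (4 ≤ s))
mainTheorem4 t s 2≤t+s gdd = t+s≡1 , s≡0⊎1 , large
  where
  t+s≡1 : (t + s) % 3 ≡ 1
  t+s≡1 = GDD4Exists⇒t+s≡1-mod3 (≤-trans (s≤s z≤n) 2≤t+s) gdd
  s≡0⊎1 : s % 4 ≡ 0 ⊎ s % 4 ≡ 1
  s≡0⊎1 = GDD4Exists⇒s%4≡0⊎1 gdd
  large : (4 ≤ t) ⊎ (4 ≤ s)
  large with 4 ≤? t | 4 ≤? s
  ... | yes 4≤t | _ = inj₁ 4≤t
  ... | no _ | yes 4≤s = inj₂ 4≤s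
  ... | no 4≰t | no 4≰s =
    let t≡3 , s≡1 = small-admissible⇒4³7¹ t s (≰⇒> 4≰t) (≰⇒> 4≰s) 2≤t+s t+s≡1 s≡0⊎1
    in ⊥-elim (¬GDD4Exists-4³7¹ (subst₂ GDD4Exists t≡3 s≡1 gdd))
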